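{- Let $G=(V,E)$ be a finite simple connected graph with weight function $w\colon E\to\mathbb{R}$, and let $v$ be a cut vertex of $G$ such that $G-v$ has connected components with vertex sets $V_1,\dots,V_k$. Let $G_i=G[V_i\cup\{v\}]$ with $w$ restricted to its edges. Then \[ P_{G,w}=x_v^{k-1}\prod_{i=1}^k P_{G_i,w|_{E(G_i)}}, \] where each $P_{G_i,w|_{E(G_i)}}$ is evaluated at the variables of the vertices of $G_i$.
   Context: For a weighted graph $(G,w)$ with a variable $x_u$ for each vertex $u$, $P_{G,w}=\sum_{T}\prod_{e\in E(T)}w(e)\prod_{u}x_u^{\deg_T(u)-1}$, the sum over all spanning trees $T$ of $G$. $G[U]$ denotes the subgraph induced on $U$. -}

module Defs where

open import Level using (Level)
open import Data.Bool using (Bool; true; false; _∧_; _∨_; not; if_then_else_)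
open import Data.Nat using (ℕ; zero; suc; _∸_; _<ᵇ_)
open import Data.Fin using (Fin; toℕ; _≟_)
open import Data.List using (List; []; _∷_; map; length; foldr; concatMap; _++_)
open import Data.Bool.ListAction using (all; any)
open import Data.List using () renaming (allFin to allFinL)
open import Data.Product using (_×_; _,_; proj₁; proj₂)
open import Relation.Nullary.Decidable using (⌊_⌋)
open import Relation.Binary.PropositionalEquality using (_≡_)
open import Algebra.Bundles using (CommutativeRing)

record SimpleGraph (n : ℕ) : Set where
  field
    adj    : Fin n → Fin n → Bool
    sym    : ∀ i j → adj i j ≡ adj j i
    irrefl : ∀ i → adj i i ≡ false
open SimpleGraph public

boolFilter : ∀ {a} {A : Set a} → (A → Bool) → List A → List A
boolFilter p []       = []
boolFilter p (x ∷ xs) = if p x then x ∷ boolFilter p xs else boolFilter p xs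

VSet : ℕ → Set
VSet n = Fin n → Bool

_==_ : ∀ {n} → Fin n → Fin n → Bool
a == b = ⌊ a ≟ b ⌋

allV : ∀ {n} → VSet n
allV _ = true

_∪₁_ : ∀ {n} → VSet n → Fin n → VSet n
(U ∪₁ v) u = U u ∨ (u == v)

-- an (undirected) edge {i,j} is stored once as the pair (i , j) with i < j
Edge : ℕ → Set
Edge n = Fin n × Fin n

allPairs : ∀ n → List (Edge n)
allPairs n = concatMap (λ i → map (λ j → (i , j)) (allFinL n)) (allFinL n)

edgesIn : ∀ {n} → SimpleGraph n → VSet n → List (Edge n)
edgesIn {n} G U =
  boolFilter (λ e → (toℕ (proj₁ e) <ᵇ toℕ (proj₂ e)) ∧ adj G (proj₁ e) (proj₂ e)
                     ∧ U (proj₁ e) ∧ U (proj₂ e))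
             (allPairs n)

-- all sub-lists (= all subsets of a duplicate-free list)
sublists : ∀ {a} {A : Set a} → List A → List (List A)
sublists []       = [] ∷ []
sublists (x ∷ xs) = let r = sublists xs in map (x ∷_) r ++ r

picks : ∀ {a} {A : Set a} → List A → List (A × List A)
picks []       = []
picks (x ∷ xs) = (x , xs) ∷ map (λ p → proj₁ p , x ∷ proj₂ p) (picks xs)

step : ∀ {n} → List (Edge n) → VSet n → VSet n
step S R b = R b ∨ any (λ e → (R (proj₁ e) ∧ (b == proj₂ e)) ∨ (R (proj₂ e) ∧ (b == proj₁ e))) S

iter : ∀ {n} → ℕ → List (Edge n) → VSet n → VSet n
iter zero    S R = R
iter (suc k) S R = iter k S (step S R)

-- reach S a b = true  iff  b is joined to a by a path using edges of S
-- (paths of length < n suffice, so n iterations are enough)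
reach : ∀ {n} → List (Edge n) → Fin n → Fin n → Bool
reach {n} S a = iter n S (λ b → a == b)

connectedOn : ∀ {n} → VSet n → List (Edge n) → Bool
connectedOn {n} U S =
  all (λ a → all (λ b → not (U a ∧ U b) ∨ reach S a b) (allFinL n)) (allFinL n)

-- S is acyclic: no edge of S lies on a cycle, i.e. the endpoints of
-- each edge e ∈ S are not joined by a path in S ∖ {e}
acyclic : ∀ {n} → List (Edge n) → Bool
acyclic S = all (λ p → not (reach (proj₂ p) (proj₁ (proj₁ p)) (proj₂ (proj₁ p)))) (picks S)

-- spanning tree of G[U] (S is taken among the edges of G[U])
isSpanningTree : ∀ {n} → VSet n → List (Edge n) → Bool
isSpanningTree U S = connectedOn U S ∧ acyclic S

spanningTrees : ∀ {n} → SimpleGraph n → VSet n → List (List (Edge n))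
spanningTrees G U = boolFilter (isSpanningTree U) (sublists (edgesIn G U))

isConnected : ∀ {n} → SimpleGraph n → VSet n → Bool
isConnected G U = connectedOn U (edgesIn G U)

deg : ∀ {n} → List (Edge n) → Fin n → ℕ
deg S u = length (boolFilter (λ e → (u == proj₁ e) ∨ (u == proj₂ e)) S)

module _ {c ℓ : Level} (R : CommutativeRing c ℓ) where
  open CommutativeRing R

  pow : Carrier → ℕ → Carrier
  pow a zero    = 1#
  pow a (suc k) = a * pow a k

  sumL : List Carrier → Carrier
  sumL = foldr _+_ 0#

  prodL : List Carrier → Carrier
  prodL = foldr _*_ 1#

  prodFin : (k : ℕ) → (Fin k → Carrier) → Carrier
  prodFin k f = prodL (map f (allFinL k))

  -- P_{G[U], w}(x) = Σ_T Π_{e ∈ T} w(e) Π_{u ∈ U} x_u^{deg_T(u) - 1}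
  -- w(e) for the edge e = {i,j}, i<j, is  w i j.
  P : ∀ {n} → SimpleGraph n → (Fin n → Fin n → Carrier) → (Fin n → Carrier)
      → VSet n → Carrier
  P {n} G w x U =
    sumL (map (λ T → prodL (map (λ e → w (proj₁ e) (proj₂ e)) T)
                     * prodL (map (λ u → pow (x u) (deg T u ∸ 1))
                                  (boolFilter U (allFinL n))))
              (spanningTrees G U))

-- Cutting the edge set of G at v into the blocks G[Vᵢ ∪ {v}] is a bijection between
-- spanning trees T of G and tuples of spanning trees Tᵢ of the blocks, because every
-- path of G leaving a block passes through v.  Under it the weight of T is the product
-- of the weights of the Tᵢ, every u ≠ v keeps its degree, and deg_T v = Σᵢ deg_{Tᵢ} v
-- with each deg_{Tᵢ} v ≥ 1, so x_v^{deg_T v - 1} = x_v^{k-1} Πᵢ x_v^{deg_{Tᵢ} v - 1}.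
-- Summing over all edge subsets, which factor in the same way, gives the identity.
module Submission where

open import Defs hiding (sym)
open import Level using (Level)
open import Algebra.Bundles using (CommutativeMonoid; CommutativeRing)
import Algebra.Properties.CommutativeMonoid.Sum as CommutativeMonoidSum
open import Data.Bool using (Bool; true; false; _∧_; _∨_; not; if_then_else_)
open import Data.Bool.Properties using (∧-comm; ¬-not) renaming (_≟_ to _≟ᵇ_)
open import Data.Bool.ListAction using (all; any)
open import Data.Empty using (⊥-elim)
open import Data.Fin using (Fin; zero; suc; toℕ; _≟_)
open import Data.Fin.Properties using (all?; ¬∀⟶∃¬; suc-injective)
open import Data.List using (List; []; _∷_; map; length; foldr; _++_; tabulate)
open import Data.List using () renaming (allFin to allFinL)
open import Data.List.Properties using (length-tabulate; map-tabulate; map-++; map-∘; map-cong-local)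
import Data.List.Relation.Unary.All as All
open import Data.List.Membership.Propositional using (_∈_)
open import Data.List.Membership.Propositional.Properties using (∈-allFin; ∈-map⁺; ∈-map⁻; ∈-++⁻)
open import Data.List.Relation.Binary.Subset.Propositional using (_⊆_)
open import Data.List.Relation.Unary.Any using (here; there)
open import Data.Nat using (ℕ; zero; suc; _∸_; _≤_; _<_; _<ᵇ_; z≤n; s≤s) renaming (_+_ to _+ℕ_)
open import Data.Nat.Properties
  using (≤-refl; ≤-trans; m≤n⇒m≤1+n; +-suc; +-monoʳ-≤; +-comm; 1+n≰n; +-∸-comm)
import Data.Nat.Properties as ℕₚ
open import Data.Product using (_×_; _,_; proj₁; proj₂; ∃; Σ)
open import Data.Sum using (_⊎_; inj₁; inj₂)
open import Function using (_∘_)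
open import Relation.Nullary using (yes; no)
open import Relation.Binary.PropositionalEquality using (_≡_; _≢_; refl; sym; trans; cong; cong₂; subst)
import Relation.Binary.Reasoning.Setoid as SetoidReasoning

private
  variable
    a : Level
    A : Set a
    n : ℕ

∧-true⁻ : ∀ {b c} → (b ∧ c) ≡ true → b ≡ true × c ≡ true
∧-true⁻ {true} {true} _ = refl , refl

∧-true⁺ : ∀ {b c} → b ≡ true → c ≡ true → (b ∧ c) ≡ true
∧-true⁺ refl refl = refl

∨-true⁻ : ∀ {b c} → (b ∨ c) ≡ true → b ≡ true ⊎ c ≡ true
∨-true⁻ {true} _ = inj₁ refl
∨-true⁻ {false} {true} _ = inj₂ refl

∨-true⁺ˡ : ∀ {b c} → b ≡ true → (b ∨ c) ≡ true
∨-true⁺ˡ refl = refl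

∨-true⁺ʳ : ∀ {b c} → c ≡ true → (b ∨ c) ≡ true
∨-true⁺ʳ {true} _ = refl
∨-true⁺ʳ {false} refl = refl

not-true⁻ : ∀ {b} → not b ≡ true → b ≡ false
not-true⁻ {false} _ = refl

true≢false : true ≢ false
true≢false ()

==⇒≡ : {u w : Fin n} → (u == w) ≡ true → u ≡ w
==⇒≡ {u = u} {w} p with u ≟ w
... | yes u≡w = u≡w

==-refl : (u : Fin n) → (u == u) ≡ true
==-refl u with u ≟ u
... | yes _ = refl
... | no u≢u = ⊥-elim (u≢u refl)

≢⇒==-false : {u w : Fin n} → u ≢ w → (u == w) ≡ false
≢⇒==-false {u = u} {w} u≢w with u ≟ w
... | yes u≡w = ⊥-elim (u≢w u≡w)
... | no _ = refl

Fin-cases : (u w : Fin n) → u ≡ w ⊎ u ≢ w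
Fin-cases u w with u ≟ w
... | yes u≡w = inj₁ u≡w
... | no u≢w = inj₂ u≢w

all⁻ : (p : A → Bool) (xs : List A) → all p xs ≡ true → ∀ {x} → x ∈ xs → p x ≡ true
all⁻ p (y ∷ xs) h (here refl) = proj₁ (∧-true⁻ h)
all⁻ p (y ∷ xs) h (there x∈) = all⁻ p xs (proj₂ (∧-true⁻ {p y} h)) x∈

all⁺ : (p : A → Bool) (xs : List A) → (∀ {x} → x ∈ xs → p x ≡ true) → all p xs ≡ true
all⁺ p [] h = refl
all⁺ p (y ∷ xs) h = ∧-true⁺ (h (here refl)) (all⁺ p xs (h ∘ there))

any⁻ : (p : A → Bool) (xs : List A) → any p xs ≡ true → ∃ λ x → x ∈ xs × p x ≡ true
any⁻ p (y ∷ xs) h with ∨-true⁻ {p y} h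
... | inj₁ py = y , here refl , py
... | inj₂ h′ with any⁻ p xs h′
... | x , x∈ , px = x , there x∈ , px

any⁺ : (p : A → Bool) (xs : List A) {x : A} → x ∈ xs → p x ≡ true → any p xs ≡ true
any⁺ p (y ∷ xs) (here refl) px = ∨-true⁺ˡ px
any⁺ p (y ∷ xs) (there x∈) px = ∨-true⁺ʳ {p y} (any⁺ p xs x∈ px)

any-cong : (p q : A → Bool) (xs : List A) → (∀ x → p x ≡ q x) → any p xs ≡ any q xs
any-cong p q [] h = refl
any-cong p q (y ∷ xs) h = cong₂ _∨_ (h y) (any-cong p q xs h)

∈-boolFilter⁻ : (p : A → Bool) (xs : List A) {x : A} → x ∈ boolFilter p xs → x ∈ xs × p x ≡ true
∈-boolFilter⁻ p (y ∷ xs) x∈ with p y in py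
∈-boolFilter⁻ p (y ∷ xs) (here refl) | true = here refl , py
∈-boolFilter⁻ p (y ∷ xs) (there x∈) | true = let x∈xs , px = ∈-boolFilter⁻ p xs x∈ in there x∈xs , px
∈-boolFilter⁻ p (y ∷ xs) x∈ | false = let x∈xs , px = ∈-boolFilter⁻ p xs x∈ in there x∈xs , px

∈-boolFilter⁺ : (p : A → Bool) (xs : List A) {x : A} → x ∈ xs → p x ≡ true → x ∈ boolFilter p xs
∈-boolFilter⁺ p (y ∷ xs) (here refl) px rewrite px = here refl
∈-boolFilter⁺ p (y ∷ xs) (there x∈) px with p y
... | true = there (∈-boolFilter⁺ p xs x∈ px)
... | false = ∈-boolFilter⁺ p xs x∈ px

boolFilter-cong : (p q : A → Bool) (xs : List A) → (∀ {x} → x ∈ xs → p x ≡ q x) →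
                  boolFilter p xs ≡ boolFilter q xs
boolFilter-cong p q [] h = refl
boolFilter-cong p q (y ∷ xs) h rewrite h (here refl) with q y
... | true = cong (y ∷_) (boolFilter-cong p q xs (h ∘ there))
... | false = boolFilter-cong p q xs (h ∘ there)

boolFilter-boolFilter : (p q : A → Bool) (xs : List A) →
                        boolFilter p (boolFilter q xs) ≡ boolFilter (λ x → q x ∧ p x) xs
boolFilter-boolFilter p q [] = refl
boolFilter-boolFilter p q (y ∷ xs) with q y
... | false = boolFilter-boolFilter p q xs
... | true with p y
...   | true = cong (y ∷_) (boolFilter-boolFilter p q xs)
...   | false = boolFilter-boolFilter p q xs

boolFilter-comm : (p q : A → Bool) (xs : List A) →
                  boolFilter p (boolFilter q xs) ≡ boolFilter q (boolFilter p xs)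
boolFilter-comm p q xs = begin
  boolFilter p (boolFilter q xs)       ≡⟨ boolFilter-boolFilter p q xs ⟩
  boolFilter (λ x → q x ∧ p x) xs      ≡⟨ boolFilter-cong _ _ xs (λ {x} _ → ∧-comm (q x) (p x)) ⟩
  boolFilter (λ x → p x ∧ q x) xs      ≡⟨ sym (boolFilter-boolFilter q p xs) ⟩
  boolFilter q (boolFilter p xs)       ∎
  where open Relation.Binary.PropositionalEquality.≡-Reasoning

boolFilter-all : (p : A → Bool) (xs : List A) → (∀ {x} → x ∈ xs → p x ≡ true) → boolFilter p xs ≡ xs
boolFilter-all p [] h = refl
boolFilter-all p (y ∷ xs) h rewrite h (here refl) = cong (y ∷_) (boolFilter-all p xs (h ∘ there))

boolFilter-none : (p : A → Bool) (xs : List A) → (∀ {x} → x ∈ xs → p x ≡ false) → boolFilter p xs ≡ []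
boolFilter-none p [] h = refl
boolFilter-none p (y ∷ xs) h rewrite h (here refl) = boolFilter-none p xs (h ∘ there)

length-boolFilter : (p : A → Bool) (xs : List A) → length (boolFilter p xs) ≤ length xs
length-boolFilter p [] = z≤n
length-boolFilter p (y ∷ xs) with p y
... | true = s≤s (length-boolFilter p xs)
... | false = m≤n⇒m≤1+n (length-boolFilter p xs)

length-boolFilter-mono : (p q : A → Bool) (xs : List A) → (∀ x → p x ≡ true → q x ≡ true) →
                         length (boolFilter p xs) ≤ length (boolFilter q xs)
length-boolFilter-mono p q [] p⇒q = z≤n
length-boolFilter-mono p q (y ∷ xs) p⇒q with p y in py | q y in qy
... | true  | true  = s≤s (length-boolFilter-mono p q xs p⇒q)
... | true  | false = ⊥-elim (true≢false (trans (sym (p⇒q y py)) qy))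
... | false | true  = m≤n⇒m≤1+n (length-boolFilter-mono p q xs p⇒q)
... | false | false = length-boolFilter-mono p q xs p⇒q

length-boolFilter-strict : (p q : A → Bool) (xs : List A) → (∀ x → p x ≡ true → q x ≡ true) →
                           ∀ {z} → z ∈ xs → p z ≡ false → q z ≡ true →
                           length (boolFilter p xs) < length (boolFilter q xs)
length-boolFilter-strict p q (y ∷ xs) p⇒q (here refl) pz qz rewrite pz | qz =
  s≤s (length-boolFilter-mono p q xs p⇒q)
length-boolFilter-strict p q (y ∷ xs) p⇒q (there z∈) pz qz with p y in py | q y in qy
... | true  | true  = s≤s (length-boolFilter-strict p q xs p⇒q z∈ pz qz)
... | true  | false = ⊥-elim (true≢false (trans (sym (p⇒q y py)) qy))
... | false | true  = m≤n⇒m≤1+n (length-boolFilter-strict p q xs p⇒q z∈ pz qz)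
... | false | false = length-boolFilter-strict p q xs p⇒q z∈ pz qz

boolFilter-map-suc : (p : Fin (suc n) → Bool) (us : List (Fin n)) →
                     boolFilter p (map suc us) ≡ map suc (boolFilter (p ∘ suc) us)
boolFilter-map-suc p [] = refl
boolFilter-map-suc p (u ∷ us) with p (suc u)
... | true = cong (suc u ∷_) (boolFilter-map-suc p us)
... | false = boolFilter-map-suc p us

allFin-suc : ∀ n → allFinL (suc n) ≡ zero ∷ map suc (allFinL n)
allFin-suc n = cong (zero ∷_) (sym (map-tabulate (λ u → u) suc))

boolFilter-==-allFin : (v : Fin n) → boolFilter (_== v) (allFinL n) ≡ v ∷ []
boolFilter-==-allFin {suc n} v = trans (cong (boolFilter (_== v)) (allFin-suc n)) (after-zero v)
  where
  after-zero : ∀ v → boolFilter (_== v) (zero ∷ map suc (allFinL n)) ≡ v ∷ []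
  after-zero zero = cong (zero ∷_) (trans (boolFilter-map-suc (_== zero) (allFinL n))
    (cong (map suc) (boolFilter-none _ (allFinL n) (λ {u} _ → ≢⇒==-false {u = suc u} {zero} λ ()))))
  after-zero (suc v) rewrite ≢⇒==-false {u = zero} {suc v} (λ ()) =
    trans (boolFilter-map-suc (_== suc v) (allFinL n))
          (cong (map suc) (trans (boolFilter-cong _ (_== v) (allFinL n) (λ {u} _ → suc-== u))
                                 (boolFilter-==-allFin v)))
    where
    suc-== : ∀ u → (suc u == suc v) ≡ (u == v)
    suc-== u with Fin-cases u v
    ... | inj₁ refl = trans (==-refl (suc u)) (sym (==-refl u))
    ... | inj₂ u≢v = trans (≢⇒==-false (u≢v ∘ suc-injective)) (sym (≢⇒==-false u≢v))

sublists-⊆ : (xs : List A) {ys : List A} → ys ∈ sublists xs → ys ⊆ xs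
sublists-⊆ [] (here refl) ()
sublists-⊆ (x ∷ xs) ys∈ y∈ with ∈-++⁻ (map (x ∷_) (sublists xs)) ys∈
... | inj₂ ys∈′ = there (sublists-⊆ xs ys∈′ y∈)
... | inj₁ ys∈′ with ∈-map⁻ (x ∷_) ys∈′
...   | zs , zs∈ , refl with y∈
...     | here y≡x = here y≡x
...     | there y∈zs = there (sublists-⊆ xs zs∈ y∈zs)

picks-⊆ : (xs : List A) {x : A} {ys : List A} → (x , ys) ∈ picks xs → x ∈ xs × ys ⊆ xs
picks-⊆ (y ∷ xs) (here refl) = here refl , there
picks-⊆ (y ∷ xs) (there p∈) with ∈-map⁻ (λ p → proj₁ p , y ∷ proj₂ p) p∈
... | _ , p∈′ , refl with picks-⊆ xs p∈′
...   | x∈ , ys⊆ = there x∈ , λ { (here z≡y) → here z≡y ; (there z∈) → there (ys⊆ z∈) }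

picks-boolFilter⁻ : (p : A → Bool) (xs : List A) {x : A} {ys′ : List A} →
  (x , ys′) ∈ picks (boolFilter p xs) →
  ∃ λ ys → (x , ys) ∈ picks xs × ys′ ≡ boolFilter p ys × p x ≡ true
picks-boolFilter⁻ p (y ∷ xs) p∈ with p y in py
picks-boolFilter⁻ p (y ∷ xs) (here refl) | true = xs , here refl , refl , py
picks-boolFilter⁻ p (y ∷ xs) (there p∈) | true with ∈-map⁻ (λ q → proj₁ q , y ∷ proj₂ q) p∈
... | _ , p∈′ , refl with picks-boolFilter⁻ p xs p∈′
...   | ys , ys∈ , refl , px = y ∷ ys , there (∈-map⁺ (λ q → proj₁ q , y ∷ proj₂ q) ys∈) , filter-∷ , px
  where
  filter-∷ : y ∷ boolFilter p ys ≡ boolFilter p (y ∷ ys)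
  filter-∷ rewrite py = refl
picks-boolFilter⁻ p (y ∷ xs) p∈ | false with picks-boolFilter⁻ p xs p∈
... | ys , ys∈ , refl , px = y ∷ ys , there (∈-map⁺ (λ q → proj₁ q , y ∷ proj₂ q) ys∈) , filter-∷ , px
  where
  filter-∷ : boolFilter p ys ≡ boolFilter p (y ∷ ys)
  filter-∷ rewrite py = refl

picks-boolFilter⁺ : (p : A → Bool) (xs : List A) {x : A} {ys : List A} →
  (x , ys) ∈ picks xs → p x ≡ true → (x , boolFilter p ys) ∈ picks (boolFilter p xs)
picks-boolFilter⁺ p (y ∷ xs) (here refl) px rewrite px = here refl
picks-boolFilter⁺ p (y ∷ xs) (there p∈) px with ∈-map⁻ (λ q → proj₁ q , y ∷ proj₂ q) p∈
... | _ , p∈′ , refl with p y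
...   | true = there (∈-map⁺ (λ q → proj₁ q , y ∷ proj₂ q) (picks-boolFilter⁺ p xs p∈′ px))
...   | false = picks-boolFilter⁺ p xs p∈′ px

Adj : List (Edge n) → Fin n → Fin n → Set
Adj S b c = ∃ λ e → e ∈ S × ((proj₁ e ≡ b × proj₂ e ≡ c) ⊎ (proj₂ e ≡ b × proj₁ e ≡ c))

data Path (S : List (Edge n)) (a : Fin n) : Fin n → Set where
  [] : Path S a a
  _▷_ : ∀ {b c} → Path S a b → Adj S b c → Path S a c

infixl 5 _▷_ _++ₚ_

_++ₚ_ : ∀ {S : List (Edge n)} {a b c} → Path S a b → Path S b c → Path S a c
p ++ₚ [] = p
p ++ₚ (q ▷ bc) = (p ++ₚ q) ▷ bc

Adj-sym : ∀ {S : List (Edge n)} {b c} → Adj S b c → Adj S c b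
Adj-sym (e , e∈ , inj₁ (x , y)) = e , e∈ , inj₂ (y , x)
Adj-sym (e , e∈ , inj₂ (x , y)) = e , e∈ , inj₁ (y , x)

Path-sym : ∀ {S : List (Edge n)} {a b} → Path S a b → Path S b a
Path-sym [] = []
Path-sym (p ▷ bc) = ([] ▷ Adj-sym bc) ++ₚ Path-sym p

Path-mono : ∀ {S S′ : List (Edge n)} → S ⊆ S′ → ∀ {a b} → Path S a b → Path S′ a b
Path-mono S⊆S′ [] = []
Path-mono S⊆S′ (p ▷ (e , e∈ , ends)) = Path-mono S⊆S′ p ▷ (e , S⊆S′ e∈ , ends)

incident : Fin n → Edge n → Bool
incident u e = (u == proj₁ e) ∨ (u == proj₂ e)

Path-incident : ∀ {S : List (Edge n)} {a b} → Path S a b → a ≢ b → ∃ λ e → e ∈ S × incident b e ≡ true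
Path-incident [] a≢a = ⊥-elim (a≢a refl)
Path-incident {b = b} (p ▷ (e , e∈ , inj₁ (_ , refl))) _ = e , e∈ , ∨-true⁺ʳ {b == proj₁ e} (==-refl b)
Path-incident {b = b} (p ▷ (e , e∈ , inj₂ (_ , refl))) _ = e , e∈ , ∨-true⁺ˡ (==-refl b)

module Reachability (S : List (Edge n)) where

  entersVia : VSet n → Fin n → Edge n → Bool
  entersVia R c e = (R (proj₁ e) ∧ (c == proj₂ e)) ∨ (R (proj₂ e) ∧ (c == proj₁ e))

  step-sound : ∀ R c → step S R c ≡ true → R c ≡ true ⊎ ∃ λ b → R b ≡ true × Adj S b c
  step-sound R c h with ∨-true⁻ {R c} h
  ... | inj₁ Rc = inj₁ Rc
  ... | inj₂ h′ with any⁻ (entersVia R c) S h′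
  ... | e , e∈ , enters with ∨-true⁻ {R (proj₁ e) ∧ (c == proj₂ e)} enters
  ...   | inj₁ fwd = let R₁ , c≡₂ = ∧-true⁻ fwd in
                     inj₂ (proj₁ e , R₁ , e , e∈ , inj₁ (refl , sym (==⇒≡ c≡₂)))
  ...   | inj₂ bwd = let R₂ , c≡₁ = ∧-true⁻ bwd in
                     inj₂ (proj₂ e , R₂ , e , e∈ , inj₂ (refl , sym (==⇒≡ c≡₁)))

  step-Adj : ∀ R {b c} → R b ≡ true → Adj S b c → step S R c ≡ true
  step-Adj R {c = c} Rb (e , e∈ , inj₁ (refl , refl)) =
    ∨-true⁺ʳ {R c} (any⁺ (entersVia R c) S e∈ (∨-true⁺ˡ (∧-true⁺ Rb (==-refl c))))
  step-Adj R {c = c} Rb (e , e∈ , inj₂ (refl , refl)) =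
    ∨-true⁺ʳ {R c} (any⁺ (entersVia R c) S e∈
                     (∨-true⁺ʳ {R (proj₁ e) ∧ (c == proj₂ e)} (∧-true⁺ Rb (==-refl c))))

  step-inflationary : ∀ R c → R c ≡ true → step S R c ≡ true
  step-inflationary R c = ∨-true⁺ˡ

  iter-sound : ∀ k R c → iter k S R c ≡ true → ∃ λ b → R b ≡ true × Path S b c
  iter-sound zero R c h = c , h , []
  iter-sound (suc k) R c h with iter-sound k (step S R) c h
  ... | b′ , stepb′ , p with step-sound R b′ stepb′
  ...   | inj₁ Rb′ = b′ , Rb′ , p
  ...   | inj₂ (b , Rb , bb′) = b , Rb , ([] ▷ bb′) ++ₚ p

  iter-inflationary : ∀ k R c → R c ≡ true → iter k S R c ≡ true
  iter-inflationary zero R c h = h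
  iter-inflationary (suc k) R c h = iter-inflationary k (step S R) c (step-inflationary R c h)

  step-cong : ∀ R R′ → (∀ b → R b ≡ R′ b) → ∀ c → step S R c ≡ step S R′ c
  step-cong R R′ R≗R′ c = cong₂ _∨_ (R≗R′ c) (any-cong (entersVia R c) (entersVia R′ c) S
    (λ e → cong₂ _∨_ (cong (_∧ (c == proj₂ e)) (R≗R′ (proj₁ e)))
                     (cong (_∧ (c == proj₁ e)) (R≗R′ (proj₂ e)))))

  iter-cong : ∀ k R R′ → (∀ b → R b ≡ R′ b) → ∀ c → iter k S R c ≡ iter k S R′ c
  iter-cong zero R R′ R≗R′ = R≗R′
  iter-cong (suc k) R R′ R≗R′ = iter-cong k (step S R) (step S R′) (step-cong R R′ R≗R′)

  Closed : VSet n → Set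
  Closed R = ∀ b → step S R b ≡ R b

  Closed-cong : ∀ R R′ → (∀ b → R b ≡ R′ b) → Closed R → Closed R′
  Closed-cong R R′ R≗R′ closed b = trans (sym (step-cong R R′ R≗R′ b)) (trans (closed b) (R≗R′ b))

  iter-closed : ∀ k R → Closed R → ∀ c → iter k S R c ≡ R c
  iter-closed zero R closed c = refl
  iter-closed (suc k) R closed c = trans (iter-cong k (step S R) R closed c) (iter-closed k R closed c)

  size : VSet n → ℕ
  size R = length (boolFilter R (allFinL n))

  size≤n : ∀ R → size R ≤ n
  size≤n R = subst (size R ≤_) (length-tabulate {n = n} (λ u → u)) (length-boolFilter R (allFinL n))

  step-grows : ∀ R {b} → step S R b ≢ R b → suc (size R) ≤ size (step S R)
  step-grows R {b} changed =
    length-boolFilter-strict R (step S R) (allFinL n) (step-inflationary R) (∈-allFin b) (proj₁ added) (proj₂ added)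
    where
    newly-true : ∀ x y → (x ≡ true → y ≡ true) → y ≢ x → x ≡ false × y ≡ true
    newly-true false true _ _ = refl , refl
    newly-true false false _ y≢x = ⊥-elim (y≢x refl)
    newly-true true y x⇒y y≢x = ⊥-elim (y≢x (x⇒y refl))
    added : R b ≡ false × step S R b ≡ true
    added = newly-true (R b) (step S R b) (step-inflationary R b) changed

  iter-closed-or-grows : ∀ m R → Closed (iter m S R) ⊎ m +ℕ size R ≤ size (iter m S R)
  iter-closed-or-grows zero R = inj₂ ≤-refl
  iter-closed-or-grows (suc m) R with all? {n = n} (λ b → step S R b ≟ᵇ R b)
  ... | yes closed = inj₁ (Closed-cong R (iter (suc m) S R) (λ b → sym (iter-closed (suc m) R closed b)) closed)
  ... | no unclosed with ¬∀⟶∃¬ n _ (λ b → step S R b ≟ᵇ R b) unclosed | iter-closed-or-grows m (step S R)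
  ...   | _ | inj₁ closed = inj₁ closed
  ...   | b , changed | inj₂ grows =
    inj₂ (≤-trans (subst (_≤ m +ℕ size (step S R)) (+-suc m (size R)) (+-monoʳ-≤ m (step-grows R changed))) grows)

  -- A nonempty subset of Fin n cannot grow n more times, so n steps reach a closed set.
  reach-closed : ∀ a → Closed (reach S a)
  reach-closed a with iter-closed-or-grows n (a ==_)
  ... | inj₁ closed = closed
  ... | inj₂ grows = ⊥-elim (1+n≰n (subst (_≤ n) (+-comm n 1)
                      (≤-trans (+-monoʳ-≤ n one≤size) (≤-trans grows (size≤n _)))))
    where
    one≤size : 1 ≤ size (a ==_)
    one≤size = ≤-trans (s≤s z≤n) (length-boolFilter-strict (λ _ → false) (a ==_) (allFinL n) (λ _ ()) (∈-allFin a) refl (==-refl a))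

  reach-sound : ∀ {a b} → reach S a b ≡ true → Path S a b
  reach-sound {a} {b} h with iter-sound n (a ==_) b h
  ... | c , a==c , p rewrite ==⇒≡ a==c = p

  reach-complete : ∀ {a b} → Path S a b → reach S a b ≡ true
  reach-complete {a} [] = iter-inflationary n (a ==_) a (==-refl a)
  reach-complete {a} (_▷_ {c = c} p bc) = trans (sym (reach-closed a c)) (step-Adj (reach S a) (reach-complete p) bc)

open Reachability using (reach-sound; reach-complete)

connectedOn⇒reach : (U : VSet n) (S : List (Edge n)) → connectedOn U S ≡ true →
                    ∀ a b → U a ≡ true → U b ≡ true → reach S a b ≡ true
connectedOn⇒reach {n} U S conn a b Ua Ub
  with ∨-true⁻ {not (U a ∧ U b)} (all⁻ _ (allFinL n) (all⁻ _ (allFinL n) conn (∈-allFin a)) (∈-allFin b))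
... | inj₂ reachable = reachable
... | inj₁ h rewrite Ua | Ub = ⊥-elim (true≢false (sym h))

reach⇒connectedOn : (U : VSet n) (S : List (Edge n)) →
                    (∀ a b → U a ≡ true → U b ≡ true → reach S a b ≡ true) → connectedOn U S ≡ true
reach⇒connectedOn {n} U S h = all⁺ _ (allFinL n) (λ {a} _ → all⁺ _ (allFinL n) (λ {b} _ → pair a b))
  where
  pair : ∀ a b → (not (U a ∧ U b) ∨ reach S a b) ≡ true
  pair a b with U a in Ua | U b in Ub
  ... | true  | true  = h a b Ua Ub
  ... | false | _     = refl
  ... | true  | false = refl

acyclic⇒ : (S : List (Edge n)) → acyclic S ≡ true →
           ∀ {e S′} → (e , S′) ∈ picks S → reach S′ (proj₁ e) (proj₂ e) ≡ false
acyclic⇒ S acyc e∈ = not-true⁻ (all⁻ _ (picks S) acyc e∈)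

⇒acyclic : (S : List (Edge n)) →
           (∀ {e S′} → (e , S′) ∈ picks S → reach S′ (proj₁ e) (proj₂ e) ≡ false) → acyclic S ≡ true
⇒acyclic S h = all⁺ _ (picks S) (λ e∈ → cong not (h e∈))

UniqueIndex : ∀ {k} → (Fin k → A → Bool) → A → Set
UniqueIndex {k = k} q x = Σ (Fin k) λ i → q i x ≡ true × (∀ j → q j x ≡ true → j ≡ i)

module PartitionedSum {c ℓ : Level} (M : CommutativeMonoid c ℓ) where

  open CommutativeMonoid M renaming (Carrier to C; refl to ≈-refl; sym to ≈-sym; trans to ≈-trans)
  open CommutativeMonoidSum M using (sum; sum-cong-≋; sum-replicate-zero)
  open SetoidReasoning setoid

  sumList : List C → C
  sumList = foldr _∙_ ε

  sum-scaleAt : ∀ {k} (f g : Fin k → C) (a : C) (i : Fin k) →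
                g i ≈ a ∙ f i → (∀ j → j ≢ i → g j ≈ f j) → sum g ≈ a ∙ sum f
  sum-scaleAt {suc k} f g a zero gi≈ g≈f = begin
    g zero ∙ sum (g ∘ suc)      ≈⟨ ∙-cong gi≈ (sum-cong-≋ (λ j → g≈f (suc j) λ ())) ⟩
    (a ∙ f zero) ∙ sum (f ∘ suc) ≈⟨ assoc _ _ _ ⟩
    a ∙ (f zero ∙ sum (f ∘ suc)) ∎
  sum-scaleAt {suc k} f g a (suc i) gi≈ g≈f = begin
    g zero ∙ sum (g ∘ suc)       ≈⟨ ∙-cong (g≈f zero λ ())
                                      (sum-scaleAt (f ∘ suc) (g ∘ suc) a i gi≈ (λ j j≢i → g≈f (suc j) (j≢i ∘ suc-injective))) ⟩
    f zero ∙ (a ∙ sum (f ∘ suc)) ≈⟨ ≈-sym (assoc _ _ _) ⟩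
    (f zero ∙ a) ∙ sum (f ∘ suc) ≈⟨ ∙-congʳ (comm _ _) ⟩
    (a ∙ f zero) ∙ sum (f ∘ suc) ≈⟨ assoc _ _ _ ⟩
    a ∙ (f zero ∙ sum (f ∘ suc)) ∎

  sumList-partition : ∀ {k} (g : A → C) (q : Fin k → A → Bool) (xs : List A) →
                      (∀ {x} → x ∈ xs → UniqueIndex q x) →
                      sumList (map g xs) ≈ sum (λ i → sumList (map g (boolFilter (q i) xs)))
  sumList-partition {k = k} g q [] _ = ≈-sym (sum-replicate-zero k)
  sumList-partition g q (x ∷ xs) unique with unique (here refl)
  ... | i , qix , only-i = ≈-trans (∙-congˡ (sumList-partition g q xs (unique ∘ there)))
                                 (≈-sym (sum-scaleAt _ _ (g x) i at-i elsewhere))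
    where
    at-i : sumList (map g (boolFilter (q i) (x ∷ xs))) ≈ g x ∙ sumList (map g (boolFilter (q i) xs))
    at-i rewrite qix = ≈-refl
    elsewhere : ∀ j → j ≢ i → sumList (map g (boolFilter (q j) (x ∷ xs))) ≈ sumList (map g (boolFilter (q j) xs))
    elsewhere j j≢i with q j x in qjx
    ... | true = ⊥-elim (j≢i (only-i j qjx))
    ... | false = ≈-refl

open CommutativeMonoidSum ℕₚ.+-0-commutativeMonoid using () renaming (sum to Σℕ; sum-cong-≗ to Σℕ-cong)
open PartitionedSum ℕₚ.+-0-commutativeMonoid using ()
  renaming (sumList to sumListℕ; sumList-partition to sumListℕ-partition)

Σℕ-pred : ∀ {k} (d : Fin k → ℕ) → (∀ i → 1 ≤ d i) → Σℕ d ≡ k +ℕ Σℕ (λ i → d i ∸ 1)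
Σℕ-pred {zero} d _ = refl
Σℕ-pred {suc k} d d≥1 with d zero | d≥1 zero
... | suc d₀ | _ = cong suc (trans (cong (d₀ +ℕ_) (Σℕ-pred (d ∘ suc) (d≥1 ∘ suc))) (x∙yz≈y∙xz d₀ k _))
  where open import Algebra.Properties.CommutativeSemigroup ℕₚ.+-commutativeSemigroup using (x∙yz≈y∙xz)

length≡sumListℕ : (xs : List A) → length xs ≡ sumListℕ (map (λ _ → 1) xs)
length≡sumListℕ [] = refl
length≡sumListℕ (x ∷ xs) = cong suc (length≡sumListℕ xs)

edgesIn⊆adj : (G : SimpleGraph n) (U : VSet n) → ∀ {e} → e ∈ edgesIn G U → adj G (proj₁ e) (proj₂ e) ≡ true
edgesIn⊆adj {n} G U {a , b} e∈ =
  proj₁ (∧-true⁻ (proj₂ (∧-true⁻ {toℕ a <ᵇ toℕ b} (proj₂ (∈-boolFilter⁻ _ (allPairs n) e∈)))))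

edgesIn-allV-restrict : (G : SimpleGraph n) (U : VSet n) →
                        boolFilter (λ e → U (proj₁ e) ∧ U (proj₂ e)) (edgesIn G allV) ≡ edgesIn G U
edgesIn-allV-restrict {n} G U =
  trans (boolFilter-boolFilter _ _ (allPairs n)) (boolFilter-cong _ _ (allPairs n) (λ {e} _ → both e))
  where
  both : ∀ e → ((toℕ (proj₁ e) <ᵇ toℕ (proj₂ e)) ∧ adj G (proj₁ e) (proj₂ e) ∧ true ∧ true) ∧ (U (proj₁ e) ∧ U (proj₂ e))
               ≡ (toℕ (proj₁ e) <ᵇ toℕ (proj₂ e)) ∧ adj G (proj₁ e) (proj₂ e) ∧ U (proj₁ e) ∧ U (proj₂ e)
  both (a , b) with toℕ a <ᵇ toℕ b | adj G a b
  ... | true  | true  = refl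
  ... | true  | false = refl
  ... | false | _     = refl

-- Blocks at a cut vertex

module CutVertex (G : SimpleGraph n) (v : Fin n) {k : ℕ} (V : Fin k → VSet n)
  (v∉V : ∀ i u → V i u ≡ true → u ≢ v)
  (V-covers : ∀ u → u ≢ v → ∃ λ i → V i u ≡ true)
  (V-disjoint : ∀ i j u → V i u ≡ true → V j u ≡ true → i ≡ j)
  (V-separated : ∀ i j a b → V i a ≡ true → V j b ≡ true → adj G a b ≡ true → i ≡ j)
  (V-nonempty : ∀ i → ∃ λ u → V i u ≡ true) where

  block : Fin k → VSet n
  block i = V i ∪₁ v

  inBlock : Fin k → Edge n → Bool
  inBlock i e = block i (proj₁ e) ∧ block i (proj₂ e)

  restrict : Fin k → List (Edge n) → List (Edge n)
  restrict i = boolFilter (inBlock i)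

  EdgesOfG : List (Edge n) → Set
  EdgesOfG S = ∀ {e} → e ∈ S → adj G (proj₁ e) (proj₂ e) ≡ true

  v∈block : ∀ i → block i v ≡ true
  v∈block i = ∨-true⁺ʳ {V i v} (==-refl v)

  V⊆block : ∀ i u → V i u ≡ true → block i u ≡ true
  V⊆block i u = ∨-true⁺ˡ

  block-cases : ∀ i u → block i u ≡ true → V i u ≡ true ⊎ u ≡ v
  block-cases i u h with ∨-true⁻ {V i u} h
  ... | inj₁ Vu = inj₁ Vu
  ... | inj₂ u==v = inj₂ (==⇒≡ u==v)

  block⇒V : ∀ i u → block i u ≡ true → u ≢ v → V i u ≡ true
  block⇒V i u h u≢v with block-cases i u h
  ... | inj₁ Vu = Vu
  ... | inj₂ u≡v = ⊥-elim (u≢v u≡v)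

  block-∩ : ∀ i j u → block i u ≡ true → block j u ≡ true → i ≢ j → u ≡ v
  block-∩ i j u ui uj i≢j with Fin-cases u v
  ... | inj₁ u≡v = u≡v
  ... | inj₂ u≢v = ⊥-elim (i≢j (V-disjoint i j u (block⇒V i u ui u≢v) (block⇒V j u uj u≢v)))

  adj⇒≢ : ∀ {a b} → adj G a b ≡ true → a ≢ b
  adj⇒≢ {a} ab refl = true≢false (trans (sym ab) (irrefl G a))

  edge-block : ∀ e → adj G (proj₁ e) (proj₂ e) ≡ true → ∃ λ i → inBlock i e ≡ true
  edge-block (a , b) ab with Fin-cases a v | Fin-cases b v
  ... | inj₁ refl | inj₁ refl = ⊥-elim (adj⇒≢ ab refl)
  ... | inj₁ refl | inj₂ b≢v = let j , Vb = V-covers b b≢v in j , ∧-true⁺ (v∈block j) (V⊆block j b Vb)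
  ... | inj₂ a≢v | inj₁ refl = let i , Va = V-covers a a≢v in i , ∧-true⁺ (V⊆block i a Va) (v∈block i)
  ... | inj₂ a≢v | inj₂ b≢v with V-covers a a≢v | V-covers b b≢v
  ...   | i , Va | j , Vb with V-separated i j a b Va Vb ab
  ...     | refl = i , ∧-true⁺ (V⊆block i a Va) (V⊆block i b Vb)

  edge-block-unique : ∀ e → adj G (proj₁ e) (proj₂ e) ≡ true →
                      ∀ i j → inBlock i e ≡ true → inBlock j e ≡ true → i ≡ j
  edge-block-unique (a , b) ab i j ei ej with Fin-cases i j
  ... | inj₁ i≡j = i≡j
  ... | inj₂ i≢j = ⊥-elim (adj⇒≢ ab (trans (block-∩ i j a (proj₁ (∧-true⁻ ei)) (proj₁ (∧-true⁻ ej)) i≢j)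
                                           (sym (block-∩ i j b (proj₂ (∧-true⁻ ei)) (proj₂ (∧-true⁻ ej)) i≢j))))

  restrict-⊆ : ∀ i S → restrict i S ⊆ S
  restrict-⊆ i S e∈ = proj₁ (∈-boolFilter⁻ (inBlock i) S e∈)

  Adj-block : ∀ i S {b c} → Adj (restrict i S) b c → block i b ≡ true × block i c ≡ true
  Adj-block i S (e , e∈ , inj₁ (refl , refl)) = ∧-true⁻ (proj₂ (∈-boolFilter⁻ (inBlock i) S e∈))
  Adj-block i S (e , e∈ , inj₂ (refl , refl)) = let b₁ , b₂ = ∧-true⁻ (proj₂ (∈-boolFilter⁻ (inBlock i) S e∈)) in b₂ , b₁

  Path-block : ∀ i S {a b} → Path (restrict i S) a b → block i a ≡ true → block i b ≡ true
  Path-block i S [] ba = ba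
  Path-block i S (p ▷ bc) ba = proj₂ (Adj-block i S bc)

  Adj-restrict : ∀ S → EdgesOfG S → ∀ {b c} → Adj S b c → ∃ λ j → Adj (restrict j S) b c × block j b ≡ true
  Adj-restrict S S⊆G (e , e∈ , ends) with edge-block e (S⊆G e∈)
  ... | j , ej = j , (e , ∈-boolFilter⁺ (inBlock j) S e∈ ej , ends) , start ends
    where
    start : ∀ {b c} → (proj₁ e ≡ b × proj₂ e ≡ c) ⊎ (proj₂ e ≡ b × proj₁ e ≡ c) → block j b ≡ true
    start (inj₁ (refl , _)) = proj₁ (∧-true⁻ ej)
    start (inj₂ (refl , _)) = proj₂ (∧-true⁻ ej)

  LeavesThroughV : List (Edge n) → Fin k → Fin n → Fin n → Set
  LeavesThroughV S i a b = Path (restrict i S) a b ⊎ (Path (restrict i S) a v × ∃ λ j → Path (restrict j S) v b)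

  leavesThroughV : ∀ S → EdgesOfG S → ∀ i {a b} → block i a ≡ true → Path S a b → LeavesThroughV S i a b
  leavesThroughV S S⊆G i ia [] = inj₁ []
  leavesThroughV S S⊆G i ia (p ▷ bc) with leavesThroughV S S⊆G i ia p | Adj-restrict S S⊆G bc
  ... | inj₁ q | j , bc′ , jb with Fin-cases i j
  ...   | inj₁ refl = inj₁ (q ▷ bc′)
  ...   | inj₂ i≢j with block-∩ i j _ (Path-block i S q ia) jb i≢j
  ...     | refl = inj₂ (q , j , [] ▷ bc′)
  leavesThroughV S S⊆G i ia (p ▷ bc) | inj₂ (q , j , r) | m , bc′ , mb with Fin-cases j m
  ...   | inj₁ refl = inj₂ (q , j , r ▷ bc′)
  ...   | inj₂ j≢m with block-∩ j m _ (Path-block j S r (v∈block j)) mb j≢m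
  ...     | refl = inj₂ (q , m , [] ▷ bc′)

  Path-restrict : ∀ S → EdgesOfG S → ∀ i {a b} → block i a ≡ true → block i b ≡ true →
                  Path S a b → Path (restrict i S) a b
  Path-restrict S S⊆G i {b = b} ia ib p with leavesThroughV S S⊆G i ia p
  ... | inj₁ q = q
  ... | inj₂ (q , j , r) with Fin-cases j i
  ...   | inj₁ refl = q ++ₚ r
  ...   | inj₂ j≢i with block-∩ j i b (Path-block j S r (v∈block j)) ib j≢i
  ...     | refl = q

  reach-restrict : ∀ S → EdgesOfG S → ∀ i {a b} → block i a ≡ true → block i b ≡ true →
                   reach S a b ≡ true → reach (restrict i S) a b ≡ true
  reach-restrict S S⊆G i ia ib r =
    reach-complete (restrict i S) (Path-restrict S S⊆G i ia ib (reach-sound S r))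

  reach-unrestrict : ∀ i S {a b} → reach (restrict i S) a b ≡ true → reach S a b ≡ true
  reach-unrestrict i S r = reach-complete S (Path-mono (restrict-⊆ i S) (reach-sound (restrict i S) r))

  connected-restrict : ∀ S → EdgesOfG S → connectedOn allV S ≡ true →
                       ∀ i → connectedOn (block i) (restrict i S) ≡ true
  connected-restrict S S⊆G conn i = reach⇒connectedOn (block i) (restrict i S)
    (λ a b ia ib → reach-restrict S S⊆G i ia ib (connectedOn⇒reach allV S conn a b refl refl))

  connected-glue : ∀ S → (∀ i → connectedOn (block i) (restrict i S) ≡ true) → connectedOn allV S ≡ true
  connected-glue S conn = reach⇒connectedOn allV S
    (λ a b _ _ → reach-complete S (Path-sym (from-v a) ++ₚ from-v b))
    where
    from-v : ∀ a → Path S v a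
    from-v a with Fin-cases a v
    ... | inj₁ refl = []
    ... | inj₂ a≢v with V-covers a a≢v
    ...   | i , Va = Path-mono (restrict-⊆ i S) (reach-sound (restrict i S)
                       (connectedOn⇒reach (block i) (restrict i S) (conn i) v a (v∈block i) (V⊆block i a Va)))

  acyclic-restrict : ∀ S → acyclic S ≡ true → ∀ i → acyclic (restrict i S) ≡ true
  acyclic-restrict S acyc i = ⇒acyclic (restrict i S) no-cycle
    where
    no-cycle : ∀ {e S′} → (e , S′) ∈ picks (restrict i S) → reach S′ (proj₁ e) (proj₂ e) ≡ false
    no-cycle {e} e∈ with picks-boolFilter⁻ (inBlock i) S e∈
    ... | S″ , e∈′ , refl , _ with reach (restrict i S″) (proj₁ e) (proj₂ e) in r
    ...   | false = refl
    ...   | true = ⊥-elim (true≢false (trans (sym (reach-unrestrict i S″ r)) (acyclic⇒ S acyc e∈′)))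

  acyclic-glue : ∀ S → EdgesOfG S → (∀ i → acyclic (restrict i S) ≡ true) → acyclic S ≡ true
  acyclic-glue S S⊆G acyc = ⇒acyclic S no-cycle
    where
    no-cycle : ∀ {e S′} → (e , S′) ∈ picks S → reach S′ (proj₁ e) (proj₂ e) ≡ false
    no-cycle {e} {S′} e∈ with picks-⊆ S e∈
    ... | e∈S , S′⊆S with edge-block e (S⊆G e∈S)
    ...   | i , ei with reach S′ (proj₁ e) (proj₂ e) in r
    ...     | false = refl
    ...     | true = ⊥-elim (true≢false (trans
                (sym (reach-restrict S′ (S⊆G ∘ S′⊆S) i (proj₁ (∧-true⁻ ei)) (proj₂ (∧-true⁻ ei)) r))
                (acyclic⇒ (restrict i S) (acyc i) (picks-boolFilter⁺ (inBlock i) S e∈ ei))))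

  spanningTree-restrict : ∀ S → EdgesOfG S → isSpanningTree allV S ≡ true →
                          ∀ i → isSpanningTree (block i) (restrict i S) ≡ true
  spanningTree-restrict S S⊆G tree i = let conn , acyc = ∧-true⁻ tree in
    ∧-true⁺ (connected-restrict S S⊆G conn i) (acyclic-restrict S acyc i)

  spanningTree-glue : ∀ S → EdgesOfG S → (∀ i → isSpanningTree (block i) (restrict i S) ≡ true) →
                      isSpanningTree allV S ≡ true
  spanningTree-glue S S⊆G trees = ∧-true⁺ (connected-glue S (proj₁ ∘ ∧-true⁻ ∘ trees))
                                           (acyclic-glue S S⊆G (proj₂ ∘ ∧-true⁻ ∘ trees))



  edge-uniqueIndex : ∀ S → EdgesOfG S → ∀ {e} → e ∈ S → UniqueIndex inBlock e
  edge-uniqueIndex S S⊆G {e} e∈ with edge-block e (S⊆G e∈)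
  ... | i , ei = i , ei , λ j ej → edge-block-unique e (S⊆G e∈) j i ej ei

  incident-inBlock : ∀ S → EdgesOfG S → ∀ i u → V i u ≡ true →
                     ∀ {e} → e ∈ S → incident u e ≡ true → inBlock i e ≡ true
  incident-inBlock S S⊆G i u Vu {e} e∈ ue with edge-block e (S⊆G e∈) | ∨-true⁻ {u == proj₁ e} ue
  ... | j , ej | inj₁ u==₁ rewrite ==⇒≡ u==₁ with V-disjoint i j _ Vu (block⇒V j _ (proj₁ (∧-true⁻ ej)) (v∉V i _ Vu))
  ...   | refl = ej
  incident-inBlock S S⊆G i u Vu {e} e∈ ue | j , ej | inj₂ u==₂ rewrite ==⇒≡ u==₂
    with V-disjoint i j _ Vu (block⇒V j _ (proj₂ (∧-true⁻ ej)) (v∉V i _ Vu))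
  ...   | refl = ej

  deg-restrict : ∀ S → EdgesOfG S → ∀ i u → V i u ≡ true → deg (restrict i S) u ≡ deg S u
  deg-restrict S S⊆G i u Vu = cong length (trans (boolFilter-boolFilter (incident u) (inBlock i) S)
                                                 (boolFilter-cong _ (incident u) S (λ {e} → keep e)))
    where
    keep : ∀ e → e ∈ S → (inBlock i e ∧ incident u e) ≡ incident u e
    keep e e∈ with incident u e in ue
    ... | false = ∧-comm (inBlock i e) false
    ... | true rewrite incident-inBlock S S⊆G i u Vu e∈ ue = refl

  deg-cutVertex : ∀ S → EdgesOfG S → deg S v ≡ Σℕ (λ i → deg (restrict i S) v)
  deg-cutVertex S S⊆G = begin
    length vEdges
      ≡⟨ length≡sumListℕ vEdges ⟩
    sumListℕ (map (λ _ → 1) vEdges)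
      ≡⟨ sumListℕ-partition (λ _ → 1) inBlock vEdges
           (λ e∈ → edge-uniqueIndex S S⊆G (proj₁ (∈-boolFilter⁻ (incident v) S e∈))) ⟩
    Σℕ (λ i → sumListℕ (map (λ _ → 1) (boolFilter (inBlock i) vEdges)))
      ≡⟨ Σℕ-cong (λ i → sym (length≡sumListℕ (boolFilter (inBlock i) vEdges))) ⟩
    Σℕ (λ i → length (restrict i vEdges))
      ≡⟨ Σℕ-cong (λ i → cong length (boolFilter-comm (inBlock i) (incident v) S)) ⟩
    Σℕ (λ i → deg (restrict i S) v) ∎
    where
    open Relation.Binary.PropositionalEquality.≡-Reasoning
    vEdges = boolFilter (incident v) S

  deg-cutVertex-positive : ∀ S i → connectedOn (block i) (restrict i S) ≡ true → 1 ≤ deg (restrict i S) v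
  deg-cutVertex-positive S i conn with V-nonempty i
  ... | u , Vu with Path-incident (Path-sym (reach-sound (restrict i S)
                      (connectedOn⇒reach (block i) (restrict i S) conn v u (v∈block i) (V⊆block i u Vu)))) (v∉V i u Vu)
  ...   | e , e∈ , ve = nonempty-length (∈-boolFilter⁺ (incident v) (restrict i S) e∈ ve)
    where
    nonempty-length : ∀ {x : Edge n} {xs} → x ∈ xs → 1 ≤ length xs
    nonempty-length (here _) = s≤s z≤n
    nonempty-length (there _) = s≤s z≤n

sum-pred : ∀ {k} (d : Fin k → ℕ) → (∀ i → 1 ≤ d i) →
           CommutativeMonoidSum.sum ℕₚ.+-0-commutativeMonoid d
             ≡ k +ℕ CommutativeMonoidSum.sum ℕₚ.+-0-commutativeMonoid (λ i → d i ∸ 1)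
sum-pred {zero} d _ = refl
sum-pred {suc k} d d≥1 with d zero | d≥1 zero
... | suc d₀ | _ = cong suc (trans (cong (d₀ +ℕ_) (sum-pred (d ∘ suc) (d≥1 ∘ suc)))
                                   (x∙yz≈y∙xz d₀ k _))
  where open import Algebra.Properties.CommutativeSemigroup ℕₚ.+-commutativeSemigroup using (x∙yz≈y∙xz)

module RingSums {c ℓ : Level} (R : CommutativeRing c ℓ) where

  open CommutativeRing R hiding (zero)
    renaming (Carrier to C; refl to ≈-refl; sym to ≈-sym; trans to ≈-trans; reflexive to ≈-reflexive)
  open import Algebra.Properties.CommutativeSemigroup +-commutativeSemigroup using (interchange)
  open CommutativeMonoidSum *-commutativeMonoid using () renaming (sum to ∏; sum-cong-≋ to ∏-cong)
  open SetoidReasoning setoid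

  prodFin≡∏ : ∀ k (f : Fin k → C) → prodFin R k f ≡ ∏ f
  prodFin≡∏ k f = trans (cong (prodL R) (map-tabulate (λ i → i) f)) (foldr-tabulate f)
    where
    foldr-tabulate : ∀ {m} (g : Fin m → C) → prodL R (tabulate g) ≡ ∏ g
    foldr-tabulate {zero} g = refl
    foldr-tabulate {suc m} g = cong (g zero *_) (foldr-tabulate (g ∘ suc))

  ∏-linearAt : ∀ {k} (f g h : Fin k → C) (i : Fin k) → h i ≈ f i + g i →
               (∀ j → j ≢ i → f j ≈ h j × g j ≈ h j) → ∏ h ≈ ∏ f + ∏ g
  ∏-linearAt {suc k} f g h zero hi≈ elsewhere = begin
    h zero * ∏ (h ∘ suc)                           ≈⟨ *-congʳ hi≈ ⟩
    (f zero + g zero) * ∏ (h ∘ suc)                ≈⟨ distribʳ _ _ _ ⟩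
    f zero * ∏ (h ∘ suc) + g zero * ∏ (h ∘ suc)    ≈⟨ +-cong (*-congˡ (∏-cong (λ j → ≈-sym (proj₁ (elsewhere (suc j) λ ())))))
                                                              (*-congˡ (∏-cong (λ j → ≈-sym (proj₂ (elsewhere (suc j) λ ()))))) ⟩
    f zero * ∏ (f ∘ suc) + g zero * ∏ (g ∘ suc)    ∎
  ∏-linearAt {suc k} f g h (suc i) hi≈ elsewhere = begin
    h zero * ∏ (h ∘ suc)                           ≈⟨ *-congʳ (≈-sym f₀≈h₀) ⟩
    f zero * ∏ (h ∘ suc)                           ≈⟨ *-congˡ (∏-linearAt (f ∘ suc) (g ∘ suc) (h ∘ suc) i hi≈
                                                                (λ j j≢i → elsewhere (suc j) (j≢i ∘ suc-injective))) ⟩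
    f zero * (∏ (f ∘ suc) + ∏ (g ∘ suc))           ≈⟨ distribˡ _ _ _ ⟩
    f zero * ∏ (f ∘ suc) + f zero * ∏ (g ∘ suc)    ≈⟨ +-congˡ (*-congʳ (≈-trans f₀≈h₀ (≈-sym g₀≈h₀))) ⟩
    f zero * ∏ (f ∘ suc) + g zero * ∏ (g ∘ suc)    ∎
    where
    f₀≈h₀ = proj₁ (elsewhere zero λ ())
    g₀≈h₀ = proj₂ (elsewhere zero λ ())

  ∏-zeroAt : ∀ {k} (f : Fin k → C) (i : Fin k) → f i ≈ 0# → ∏ f ≈ 0#
  ∏-zeroAt {suc k} f zero fi≈0 = ≈-trans (*-congʳ fi≈0) (zeroˡ _)
  ∏-zeroAt {suc k} f (suc i) fi≈0 = ≈-trans (*-congˡ (∏-zeroAt (f ∘ suc) i fi≈0)) (zeroʳ _)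

  sumL-++ : ∀ (xs ys : List C) → sumL R (xs ++ ys) ≈ sumL R xs + sumL R ys
  sumL-++ [] ys = ≈-sym (+-identityˡ _)
  sumL-++ (x ∷ xs) ys = ≈-trans (+-congˡ (sumL-++ xs ys)) (≈-sym (+-assoc _ _ _))

  sumL-+ : ∀ (f g : A → C) (xs : List A) → sumL R (map (λ x → f x + g x) xs) ≈ sumL R (map f xs) + sumL R (map g xs)
  sumL-+ f g [] = ≈-sym (+-identityˡ _)
  sumL-+ f g (x ∷ xs) = ≈-trans (+-congˡ (sumL-+ f g xs)) (interchange _ _ _ _)

  sumL-cong : ∀ (f g : A → C) (xs : List A) → (∀ {x} → x ∈ xs → f x ≈ g x) → sumL R (map f xs) ≈ sumL R (map g xs)
  sumL-cong f g [] _ = ≈-refl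
  sumL-cong f g (x ∷ xs) f≈g = +-cong (f≈g (here refl)) (sumL-cong f g xs (f≈g ∘ there))

  sumL-*ˡ : ∀ (a : C) (f : A → C) (xs : List A) → sumL R (map (λ x → a * f x) xs) ≈ a * sumL R (map f xs)
  sumL-*ˡ a f [] = ≈-sym (zeroʳ _)
  sumL-*ˡ a f (x ∷ xs) = ≈-trans (+-congˡ (sumL-*ˡ a f xs)) (≈-sym (distribˡ _ _ _))

  sumL-boolFilter : ∀ (p : A → Bool) (f : A → C) (xs : List A) →
                    sumL R (map f (boolFilter p xs)) ≈ sumL R (map (λ x → if p x then f x else 0#) xs)
  sumL-boolFilter p f [] = ≈-refl
  sumL-boolFilter p f (x ∷ xs) with p x
  ... | true = +-congˡ (sumL-boolFilter p f xs)
  ... | false = ≈-trans (sumL-boolFilter p f xs) (≈-sym (+-identityˡ _))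

  sumL-sublists-∷ : ∀ (f : List A → C) (x : A) (xs : List A) →
                    sumL R (map f (sublists (x ∷ xs))) ≈ sumL R (map (λ S → f (x ∷ S) + f S) (sublists xs))
  sumL-sublists-∷ f x xs = begin
    sumL R (map f (map (x ∷_) ss ++ ss))                     ≡⟨ cong (sumL R) (map-++ f (map (x ∷_) ss) ss) ⟩
    sumL R (map f (map (x ∷_) ss) ++ map f ss)               ≈⟨ sumL-++ (map f (map (x ∷_) ss)) (map f ss) ⟩
    sumL R (map f (map (x ∷_) ss)) + sumL R (map f ss)       ≡⟨ cong (λ l → sumL R l + sumL R (map f ss)) (sym (map-∘ ss)) ⟩
    sumL R (map (λ S → f (x ∷ S)) ss) + sumL R (map f ss)    ≈⟨ ≈-sym (sumL-+ _ _ ss) ⟩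
    sumL R (map (λ S → f (x ∷ S) + f S) ss)                  ∎
    where ss = sublists xs

  -- Choosing a subset of xs is choosing, independently for each class, a subset of that class.
  sumL-sublists-∏ : ∀ {k} (q : Fin k → A → Bool) (xs : List A) → (∀ {x} → x ∈ xs → UniqueIndex q x) →
                    (f : Fin k → List A → C) →
                    sumL R (map (λ S → ∏ (λ i → f i (boolFilter (q i) S))) (sublists xs))
                      ≈ ∏ (λ i → sumL R (map (f i) (sublists (boolFilter (q i) xs))))
  sumL-sublists-∏ {k = k} q [] _ f = ≈-trans (+-identityʳ _) (∏-cong {k} (λ i → ≈-sym (+-identityʳ _)))
  sumL-sublists-∏ {k = k} q (x ∷ xs) unique f with unique (here refl)
  ... | i , qix , only-i = begin
    sumL R (map F (sublists (x ∷ xs)))                                ≈⟨ sumL-sublists-∷ F x xs ⟩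
    sumL R (map (λ S → F (x ∷ S) + F S) (sublists xs))                ≈⟨ sumL-cong _ _ (sublists xs) (λ {S} _ → split S) ⟩
    sumL R (map (λ S → ∏ (λ j → f′ j (boolFilter (q j) S))) (sublists xs))
                                                                      ≈⟨ sumL-sublists-∏ q xs (unique ∘ there) f′ ⟩
    ∏ (λ j → sumL R (map (f′ j) (sublists (boolFilter (q j) xs))))    ≈⟨ ∏-cong f′-sublists ⟩
    ∏ (λ j → sumL R (map (f j) (sublists (boolFilter (q j) (x ∷ xs))))) ∎
    where
    F : List _ → C
    F S = ∏ (λ j → f j (boolFilter (q j) S))
    f′ : Fin k → List _ → C
    f′ j S = if q j x then f j (x ∷ S) + f j S else f j S
    split : ∀ S → F (x ∷ S) + F S ≈ ∏ (λ j → f′ j (boolFilter (q j) S))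
    split S = ≈-sym (∏-linearAt _ _ _ i at-i elsewhere)
      where
      at-i : f′ i (boolFilter (q i) S) ≈ f i (boolFilter (q i) (x ∷ S)) + f i (boolFilter (q i) S)
      at-i rewrite qix = ≈-refl
      elsewhere : ∀ j → j ≢ i → f j (boolFilter (q j) (x ∷ S)) ≈ f′ j (boolFilter (q j) S)
                              × f j (boolFilter (q j) S) ≈ f′ j (boolFilter (q j) S)
      elsewhere j j≢i with q j x in qjx
      ... | true = ⊥-elim (j≢i (only-i j qjx))
      ... | false = ≈-refl , ≈-refl
    f′-sublists : ∀ j → sumL R (map (f′ j) (sublists (boolFilter (q j) xs)))
                         ≈ sumL R (map (f j) (sublists (boolFilter (q j) (x ∷ xs))))
    f′-sublists j with q j x
    ... | true = ≈-sym (sumL-sublists-∷ (f j) x (boolFilter (q j) xs))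
    ... | false = ≈-refl

  pow-homo-+ : ∀ a m n → pow R a (m +ℕ n) ≈ pow R a m * pow R a n
  pow-homo-+ a zero n = ≈-sym (*-identityˡ _)
  pow-homo-+ a (suc m) n = ≈-trans (*-congˡ (pow-homo-+ a m n)) (≈-sym (*-assoc _ _ _))

  pow-Σℕ : ∀ {k} a (d : Fin k → ℕ) → pow R a (Σℕ d) ≈ ∏ (λ i → pow R a (d i))
  pow-Σℕ {zero} a d = ≈-refl
  pow-Σℕ {suc k} a d = ≈-trans (pow-homo-+ a (d zero) (Σℕ (d ∘ suc))) (*-congˡ (pow-Σℕ a (d ∘ suc)))

module SpanningTreePolynomial {c ℓ : Level} (R : CommutativeRing c ℓ) (G : SimpleGraph n)
  (w : Fin n → Fin n → CommutativeRing.Carrier R) (x : Fin n → CommutativeRing.Carrier R)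
  (v : Fin n) {k : ℕ} (V : Fin k → VSet n) (1≤k : 1 ≤ k)
  (v∉V : ∀ i u → V i u ≡ true → u ≢ v)
  (V-covers : ∀ u → u ≢ v → ∃ λ i → V i u ≡ true)
  (V-disjoint : ∀ i j u → V i u ≡ true → V j u ≡ true → i ≡ j)
  (V-separated : ∀ i j a b → V i a ≡ true → V j b ≡ true → adj G a b ≡ true → i ≡ j)
  (V-nonempty : ∀ i → ∃ λ u → V i u ≡ true) where

  open CommutativeRing R hiding (zero)
    renaming (Carrier to C; refl to ≈-refl; sym to ≈-sym; trans to ≈-trans; reflexive to ≈-reflexive)
  open CommutativeMonoidSum *-commutativeMonoid using () renaming (sum to ∏; sum-cong-≋ to ∏-cong; ∑-distrib-+ to ∏-distrib-*)
  open PartitionedSum *-commutativeMonoid using (sumList-partition)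
  open RingSums R
  open CutVertex G v V v∉V V-covers V-disjoint V-separated V-nonempty
  open SetoidReasoning setoid

  weight : List (Edge n) → C
  weight S = prodL R (map (λ e → w (proj₁ e) (proj₂ e)) S)

  xdeg : List (Edge n) → Fin n → C
  xdeg S u = pow R (x u) (deg S u ∸ 1)

  monomial : VSet n → List (Edge n) → C
  monomial U S = prodL R (map (xdeg S) (boolFilter U (allFinL n)))

  treeTerm : VSet n → List (Edge n) → C
  treeTerm U S = if isSpanningTree U S then weight S * monomial U S else 0#

  treeTerm-tree : ∀ U S → isSpanningTree U S ≡ true → treeTerm U S ≡ weight S * monomial U S
  treeTerm-tree U S tree rewrite tree = refl

  treeTerm-nontree : ∀ U S → isSpanningTree U S ≡ false → treeTerm U S ≡ 0#
  treeTerm-nontree U S nontree rewrite nontree = refl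

  P≈sum-treeTerm : ∀ U → P R G w x U ≈ sumL R (map (treeTerm U) (sublists (edgesIn G U)))
  P≈sum-treeTerm U = sumL-boolFilter (isSpanningTree U) (λ T → weight T * monomial U T) (sublists (edgesIn G U))

  E : List (Edge n)
  E = edgesIn G allV

  E⊆G : EdgesOfG E
  E⊆G = edgesIn⊆adj G allV

  edgesIn-block : ∀ i → edgesIn G (block i) ≡ restrict i E
  edgesIn-block i = sym (edgesIn-allV-restrict G (block i))

  weight-split : ∀ S → EdgesOfG S → weight S ≈ ∏ (λ i → weight (restrict i S))
  weight-split S S⊆G = sumList-partition (λ e → w (proj₁ e) (proj₂ e)) inBlock S (edge-uniqueIndex S S⊆G)

  offV : Fin n → Bool
  offV u = not (u == v)

  others : List (Fin n)
  others = boolFilter offV (allFinL n)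

  monomial-at-v : ∀ U S → U v ≡ true →
                  monomial U S ≈ xdeg S v * prodL R (map (xdeg S) (boolFilter offV (boolFilter U (allFinL n))))
  monomial-at-v U S Uv = begin
    monomial U S                                    ≈⟨ sumList-partition (xdeg S) sideOfV Us (λ {u} _ → unique u) ⟩
    prodL R (map (xdeg S) (boolFilter (_== v) Us)) * (rest * 1#)
                                                    ≡⟨ cong (λ us → prodL R (map (xdeg S) us) * (rest * 1#)) only-v ⟩
    (xdeg S v * 1#) * (rest * 1#)                   ≈⟨ *-cong (*-identityʳ _) (*-identityʳ _) ⟩
    xdeg S v * rest                                 ∎
    where
    Us = boolFilter U (allFinL n)
    rest = prodL R (map (xdeg S) (boolFilter offV Us))
    sideOfV : Fin 2 → Fin n → Bool
    sideOfV zero u = u == v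
    sideOfV (suc _) = offV
    unique : ∀ u → UniqueIndex sideOfV u
    unique u with u == v in u==v
    ... | true = zero , u==v , λ { zero _ → refl ; (suc zero) h → ⊥-elim (true≢false (trans (sym h) (cong not u==v))) }
    ... | false = suc zero , cong not u==v , λ { zero h → ⊥-elim (true≢false (trans (sym h) u==v)) ; (suc zero) _ → refl }
    only-v : boolFilter (_== v) Us ≡ v ∷ []
    only-v rewrite boolFilter-comm (_== v) U (allFinL n) | boolFilter-==-allFin v | Uv = refl

  Vpart : List (Edge n) → Fin k → C
  Vpart S i = prodL R (map (xdeg S) (boolFilter (V i) others))

  monomial-allV : ∀ S → monomial allV S ≈ xdeg S v * ∏ (Vpart S)
  monomial-allV S = begin
    monomial allV S                                                          ≈⟨ monomial-at-v allV S refl ⟩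
    xdeg S v * prodL R (map (xdeg S) (boolFilter offV (boolFilter allV (allFinL n))))
      ≡⟨ cong (λ us → xdeg S v * prodL R (map (xdeg S) (boolFilter offV us))) (boolFilter-all allV (allFinL n) (λ _ → refl)) ⟩
    xdeg S v * prodL R (map (xdeg S) others)                                 ≈⟨ *-congˡ (sumList-partition (xdeg S) V others unique) ⟩
    xdeg S v * ∏ (Vpart S)                                                   ∎
    where
    unique : ∀ {u} → u ∈ others → UniqueIndex V u
    unique {u} u∈ with V-covers u (λ u≡v → true≢false (trans (sym (proj₂ (∈-boolFilter⁻ _ (allFinL n) u∈)))
                                                              (cong not (trans (cong (_== v) u≡v) (==-refl v)))))
    ... | i , Vu = i , Vu , λ j Vju → V-disjoint j i u Vju Vu

  monomial-block : ∀ S → EdgesOfG S → ∀ i → monomial (block i) (restrict i S) ≈ xdeg (restrict i S) v * Vpart S i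
  monomial-block S S⊆G i = begin
    monomial (block i) (restrict i S)  ≈⟨ monomial-at-v (block i) (restrict i S) (v∈block i) ⟩
    xdeg (restrict i S) v * prodL R (map (xdeg (restrict i S)) (boolFilter offV (boolFilter (block i) (allFinL n))))
      ≡⟨ cong (λ us → xdeg (restrict i S) v * prodL R us) (trans (cong (map _) same-vertices) (map-cong-local (All.tabulate same-degree))) ⟩
    xdeg (restrict i S) v * Vpart S i  ∎
    where
    same-vertices : boolFilter offV (boolFilter (block i) (allFinL n)) ≡ boolFilter (V i) others
    same-vertices = trans (boolFilter-boolFilter offV _ (allFinL n))
                          (trans (boolFilter-cong _ _ (allFinL n) (λ {u} _ → off-v u)) (sym (boolFilter-boolFilter (V i) offV (allFinL n))))
      where
      off-v : ∀ u → (block i u ∧ offV u) ≡ (offV u ∧ V i u)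
      off-v u with V i u | u == v
      ... | true  | true  = refl
      ... | true  | false = refl
      ... | false | true  = refl
      ... | false | false = refl
    same-degree : ∀ {u} → u ∈ boolFilter (V i) others → xdeg (restrict i S) u ≡ xdeg S u
    same-degree {u} u∈ = cong (λ d → pow R (x u) (d ∸ 1)) (deg-restrict S S⊆G i u (proj₂ (∈-boolFilter⁻ (V i) others u∈)))

  xᵥᵏ⁻¹ : C
  xᵥᵏ⁻¹ = pow R (x v) (k ∸ 1)

  xdeg-cutVertex : ∀ S → EdgesOfG S → (∀ i → connectedOn (block i) (restrict i S) ≡ true) →
                   xdeg S v ≈ xᵥᵏ⁻¹ * ∏ (λ i → xdeg (restrict i S) v)
  xdeg-cutVertex S S⊆G conn = begin
    pow R (x v) (deg S v ∸ 1)               ≡⟨ cong (λ m → pow R (x v) (m ∸ 1)) deg≡ ⟩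
    pow R (x v) ((k +ℕ surplus) ∸ 1)        ≡⟨ cong (pow R (x v)) (+-∸-comm surplus 1≤k) ⟩
    pow R (x v) ((k ∸ 1) +ℕ surplus)        ≈⟨ pow-homo-+ (x v) (k ∸ 1) surplus ⟩
    xᵥᵏ⁻¹ * pow R (x v) surplus             ≈⟨ *-congˡ (pow-Σℕ (x v) (λ i → d i ∸ 1)) ⟩
    xᵥᵏ⁻¹ * ∏ (λ i → xdeg (restrict i S) v) ∎
    where
    d : Fin k → ℕ
    d i = deg (restrict i S) v
    surplus = Σℕ (λ i → d i ∸ 1)
    deg≡ : deg S v ≡ k +ℕ surplus
    deg≡ = trans (deg-cutVertex S S⊆G) (Σℕ-pred d (λ i → deg-cutVertex-positive S i (conn i)))

  treeTerm-split-tree : ∀ S → EdgesOfG S → (∀ i → connectedOn (block i) (restrict i S) ≡ true) →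
    weight S * monomial allV S ≈ xᵥᵏ⁻¹ * ∏ (λ i → weight (restrict i S) * monomial (block i) (restrict i S))
  treeTerm-split-tree S S⊆G conn = begin
    weight S * monomial allV S
      ≈⟨ *-cong (weight-split S S⊆G) (monomial-allV S) ⟩
    ∏ wt * (xdeg S v * ∏ (Vpart S))
      ≈⟨ *-congˡ (*-congʳ (xdeg-cutVertex S S⊆G conn)) ⟩
    ∏ wt * ((xᵥᵏ⁻¹ * ∏ xd) * ∏ (Vpart S))
      ≈⟨ ≈-trans (*-congˡ (*-assoc _ _ _)) (x∙yz≈y∙xz _ _ _) ⟩
    xᵥᵏ⁻¹ * (∏ wt * (∏ xd * ∏ (Vpart S)))
      ≈⟨ *-congˡ (≈-sym (≈-trans (∏-distrib-* wt _) (*-congˡ (∏-distrib-* xd (Vpart S))))) ⟩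
    xᵥᵏ⁻¹ * ∏ (λ i → wt i * (xd i * Vpart S i))
      ≈⟨ *-congˡ (∏-cong (λ i → *-congˡ (≈-sym (monomial-block S S⊆G i)))) ⟩
    xᵥᵏ⁻¹ * ∏ (λ i → weight (restrict i S) * monomial (block i) (restrict i S)) ∎
    where
    open import Algebra.Properties.CommutativeSemigroup *-commutativeSemigroup using (x∙yz≈y∙xz)
    wt xd : Fin k → C
    wt i = weight (restrict i S)
    xd i = xdeg (restrict i S) v

  treeTerm-split : ∀ S → EdgesOfG S → treeTerm allV S ≈ xᵥᵏ⁻¹ * ∏ (λ i → treeTerm (block i) (restrict i S))
  treeTerm-split S S⊆G with isSpanningTree allV S in tree
  ... | true = ≈-trans (treeTerm-split-tree S S⊆G (proj₁ ∘ ∧-true⁻ ∘ trees))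
                       (*-congˡ (∏-cong (λ i → ≈-reflexive (sym (treeTerm-tree (block i) _ (trees i))))))
    where trees = spanningTree-restrict S S⊆G tree
  ... | false with all? {n = k} (λ i → isSpanningTree (block i) (restrict i S) ≟ᵇ true)
  ...   | yes trees = ⊥-elim (true≢false (trans (sym (spanningTree-glue S S⊆G trees)) tree))
  ...   | no not-all with ¬∀⟶∃¬ k _ (λ i → isSpanningTree (block i) (restrict i S) ≟ᵇ true) not-all
  ...     | i , not-tree = ≈-sym (≈-trans (*-congˡ (∏-zeroAt _ i (≈-reflexive (treeTerm-nontree (block i) _ (¬-not not-tree)))))
                                          (zeroʳ _))

  P-cutVertex : P R G w x allV ≈ xᵥᵏ⁻¹ * prodFin R k (λ i → P R G w x (block i))
  P-cutVertex = begin
    P R G w x allV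
      ≈⟨ P≈sum-treeTerm allV ⟩
    sumL R (map (treeTerm allV) (sublists E))
      ≈⟨ sumL-cong _ _ (sublists E) (λ S∈ → treeTerm-split _ (E⊆G ∘ sublists-⊆ E S∈)) ⟩
    sumL R (map (λ S → xᵥᵏ⁻¹ * ∏ (λ i → treeTerm (block i) (restrict i S))) (sublists E))
      ≈⟨ sumL-*ˡ xᵥᵏ⁻¹ _ (sublists E) ⟩
    xᵥᵏ⁻¹ * sumL R (map (λ S → ∏ (λ i → treeTerm (block i) (restrict i S))) (sublists E))
      ≈⟨ *-congˡ (sumL-sublists-∏ inBlock E (edge-uniqueIndex E E⊆G) (treeTerm ∘ block)) ⟩
    xᵥᵏ⁻¹ * ∏ (λ i → sumL R (map (treeTerm (block i)) (sublists (restrict i E))))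
      ≈⟨ *-congˡ (∏-cong (λ i → ≈-sym (≈-trans (P≈sum-treeTerm (block i))
                   (≈-reflexive (cong (λ Eᵢ → sumL R (map (treeTerm (block i)) (sublists Eᵢ))) (edgesIn-block i)))))) ⟩
    xᵥᵏ⁻¹ * ∏ (λ i → P R G w x (block i))
      ≡⟨ cong (xᵥᵏ⁻¹ *_) (sym (prodFin≡∏ k _)) ⟩
    xᵥᵏ⁻¹ * prodFin R k (λ i → P R G w x (block i)) ∎

lemma3 : ∀ {c ℓ : Level} (R : CommutativeRing c ℓ) (n : ℕ) (G : SimpleGraph n)
    (w : Fin n → Fin n → CommutativeRing.Carrier R) (x : Fin n → CommutativeRing.Carrier R)
    (v : Fin n) (k : ℕ) (V : Fin k → VSet n) →
    isConnected G allV ≡ true →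
    2 ≤ k →
    (∀ i → ∃ λ u → V i u ≡ true) →
    (∀ i u → V i u ≡ true → u ≢ v) →
    (∀ u → u ≢ v → ∃ λ i → V i u ≡ true) →
    (∀ i j u → V i u ≡ true → V j u ≡ true → i ≡ j) →
    (∀ i → isConnected G (V i) ≡ true) →
    (∀ i j a b → V i a ≡ true → V j b ≡ true → adj G a b ≡ true → i ≡ j) →
    CommutativeRing._≈_ R (P R G w x allV)
      (CommutativeRing._*_ R (pow R (x v) (k ∸ 1))
        (prodFin R k (λ i → P R G w x (V i ∪₁ v))))
lemma3 R n G w x v k V _ 2≤k V-nonempty v∉V V-covers V-disjoint _ V-separated =
  SpanningTreePolynomial.P-cutVertex R G w x v V (≤-trans (s≤s z≤n) 2≤k)
    v∉V V-covers V-disjoint V-separated V-nonempty
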